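{- Let $G=(V,E)$ be a weakly connected directed graph. Then there exists a spanning tree $T$ of $G$ such that \[ H(G-T)=\min_{F\in\mathcal{F}(G)}H(G-F), \] where $\mathcal{F}(G)$ is the set of spanning forests of $G$.
   Context: A spanning forest of a directed graph is a set of edges that is acyclic in the underlying undirected graph (orientations ignored); a spanning tree is a spanning forest that is a spanning tree of the underlying undirected graph. $G-F$ is $G$ with the edges of $F$ removed. For a directed graph $G'$ with $m'$ edges and indegrees $d_v$, $H(G')=\sum_v d_v\lg(m'/d_v)$ with $0\lg(\cdot/0)=0$, $\lg=\log_2$. -}

module Defs where

open import Data.Nat using (ℕ; zero; suc; _+_; _*_; _^_; _≤_)
open import Data.Fin using (Fin; _≟_)
open import Data.Bool using (Bool; true; false; not; _∧_; if_then_else_)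
open import Data.Vec using (Vec; lookup)
open import Data.List using (List; []; _∷_; map; allFin)
open import Data.Nat.ListAction using (sum; product)
open import Data.List.Relation.Unary.Unique.Propositional using (Unique)
open import Data.Fin.Subset using (Subset; _∈_; ⊤)
open import Data.Product using (_×_; _,_; proj₁; proj₂; ∃; Σ)
open import Relation.Binary.PropositionalEquality using (_≡_)
open import Relation.Nullary.Decidable using (⌊_⌋)

record Digraph : Set where
  field
    n    : ℕ
    m    : ℕ
    edge : Fin m → Fin n × Fin n

  src : Fin m → Fin n
  src e = proj₁ (edge e)

  tgt : Fin m → Fin n
  tgt e = proj₂ (edge e)

open Digraph public

EdgeSet : Digraph → Set
EdgeSet G = Subset (m G)

data Walk (G : Digraph) (S : EdgeSet G) : Fin (n G) → Fin (n G) → List (Fin (m G)) → Set where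
  stop : ∀ {v} → Walk G S v v []
  fwd  : ∀ {w es} (e : Fin (m G)) → e ∈ S →
         Walk G S (tgt G e) w es → Walk G S (src G e) w (e ∷ es)
  bwd  : ∀ {w es} (e : Fin (m G)) → e ∈ S →
         Walk G S (src G e) w es → Walk G S (tgt G e) w (e ∷ es)

-- S is acyclic in the underlying undirected graph: there is no nonempty
-- closed walk using pairwise distinct edges (a cycle; loops and
-- pairs of parallel edges count as cycles).
Acyclic : (G : Digraph) → EdgeSet G → Set
Acyclic G S = ∀ v es → Walk G S v v es → Unique es → es ≡ []

Connecting : (G : Digraph) → EdgeSet G → Set
Connecting G S = ∀ u v → ∃ λ es → Walk G S u v es

SpanningForest : (G : Digraph) → EdgeSet G → Set
SpanningForest G F = Acyclic G F

SpanningTree : (G : Digraph) → EdgeSet G → Set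
SpanningTree G T = Acyclic G T × Connecting G T

WeaklyConnected : Digraph → Set
WeaklyConnected G = Connecting G ⊤

b2n : Bool → ℕ
b2n true  = 1
b2n false = 0

kept : (G : Digraph) → EdgeSet G → Fin (m G) → Bool
kept G F e = not (lookup F e)

edgesLeft : (G : Digraph) → EdgeSet G → ℕ
edgesLeft G F = sum (map (λ e → b2n (kept G F e)) (allFin (m G)))

indeg : (G : Digraph) → EdgeSet G → Fin (n G) → ℕ
indeg G F v = sum (map (λ e → b2n (kept G F e ∧ ⌊ tgt G e ≟ v ⌋)) (allFin (m G)))

-- 2^{H(G-F)} = m'^{m'} / ∏_v d_v^{d_v}   (since Σ_v d_v = m', with 0^0 = 1).
-- We store numerator and denominator as naturals (denominator ≥ 1).
expHnum : (G : Digraph) → EdgeSet G → ℕ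
expHnum G F = edgesLeft G F ^ edgesLeft G F

expHden : (G : Digraph) → EdgeSet G → ℕ
expHden G F = product (map (λ v → indeg G F v ^ indeg G F v) (allFin (n G)))

-- H(G-F) ≤ H(G-F')  ⇔  2^{H(G-F)} ≤ 2^{H(G-F')}  (lg monotone),
-- cross-multiplied with positive denominators.
H≤ : (G : Digraph) → EdgeSet G → EdgeSet G → Set
H≤ G F F' = expHnum G F * expHden G F' ≤ expHnum G F' * expHden G F

{-# OPTIONS --safe #-}
-- Adding an edge e ∉ F to F deletes one edge from G − F: the edge count M + 1 and the
-- indegree d + 1 of the head of e both drop by one, so 2^H is multiplied by
-- (M^M / (M+1)^(M+1)) · ((d+1)^(d+1) / d^d) ≤ 1, because k ↦ (k+1)^(k+1) / k^k is
-- increasing (k^k is log-convex, by Bernoulli's inequality) and d ≤ M.  Hence H can only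
-- drop when a forest is extended greedily to a spanning tree.  For every edge set S let
-- T(S) be the greedy tree that takes the edges of S first; if S is a forest then T(S)
-- contains S, so H(G − T(S)) ≤ H(G − S).  A T(S) minimising H over the finitely many S
-- is the required tree.
module Submission where

open import Defs
open import Data.Product using (Σ; _×_)

open import Algebra.Bundles using (CommutativeMonoid)
open import Data.Bool using (Bool; true; false; not; _∧_)
open import Data.Bool.Properties using (¬-not; ∧-identityʳ)
open import Data.Empty using (⊥-elim)
open import Data.Fin as Fin using (Fin; _≟_)
open import Data.Fin.Properties using (punchInᵢ≢i)
open import Data.Fin.Subset using (Subset; _∈_; _∉_; _⊆_; inside; outside) renaming (⊥ to ∅)
open import Data.Fin.Subset.Properties using (∉⊥; ⊥⊆; ⊆-antisym) renaming (_∈?_ to _∈ₛ?_)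
open import Data.List using (List; []; _∷_; [_]; _++_; foldr; map; filter; allFin; tabulate)
open import Data.List.Membership.Propositional using () renaming (_∈_ to _∈ₗ_; _∉_ to _∉ₗ_)
open import Data.List.Membership.Propositional.Properties using (∈-∃++; ∈-filter⁺; ∈-allFin)
open import Data.List.Properties using (map-tabulate; map-cong)
open import Data.List.Relation.Unary.All as All using (All; []; _∷_)
open import Data.List.Relation.Unary.All.Properties using (¬Any⇒All¬; ++⁻ʳ; map⁺; all-filter)
open import Data.List.Relation.Unary.Any using (here; there)
open import Data.List.Relation.Unary.Unique.Propositional using (Unique; []; _∷_)
open import Data.List.Relation.Unary.Unique.Propositional.Properties using (Unique[x∷xs]⇒x∉xs)
open import Data.Nat using (ℕ; zero; suc; _+_; _*_; _^_; _≤_; _≤′_; ≤′-refl; ≤′-step; z≤n; NonZero)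
open import Data.Nat.ListAction using (sum)
open import Data.Nat.ListAction.Properties using (product≢0)
open import Data.Nat.Properties hiding (_≟_)
open import Data.Nat.Tactic.RingSolver using (solve-∀)
open import Data.Product using (∃; ∃₂; _,_; proj₁; proj₂; map₁)
open import Data.Sum using (_⊎_; inj₁; inj₂; [_,_]′) renaming (map to map⊎)
open import Data.Vec as Vec using (lookup; _[_]≔_)
open import Data.Vec.Functional using (removeAt)
open import Data.Vec.Properties using (lookup∘update; lookup∘update′; []=⇒lookup; lookup⇒[]=)
open import Function using (_∘_; id)
open import Relation.Binary using (Rel; Total; Transitive)
open import Relation.Binary.PropositionalEquality using (_≡_; _≢_; refl; sym; trans; cong; cong₂; subst)
open import Relation.Nullary using (¬_; Dec; yes; no; _⊎-dec_; _×-dec_)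
open import Relation.Nullary.Decidable using (map′; isYes; isYes≗does; dec-true; dec-false)
import Algebra.Properties.CommutativeSemigroup as CommSemigroupProperties
open CommSemigroupProperties *-commutativeSemigroup using (xy∙z≈x∙zy; xy∙z≈xz∙y; x∙yz≈xz∙y)

^-distribʳ-* : ∀ a b k → (a * b) ^ k ≡ a ^ k * b ^ k
^-distribʳ-* a b zero    = refl
^-distribʳ-* a b (suc k) = begin-equality
  a * b * (a * b) ^ k     ≡⟨ cong (a * b *_) (^-distribʳ-* a b k) ⟩
  a * b * (a ^ k * b ^ k) ≡⟨ [m*n]*[o*p]≡[m*o]*[n*p] a b (a ^ k) (b ^ k) ⟩
  a * a ^ k * (b * b ^ k) ∎
  where open ≤-Reasoning

-- Bernoulli's inequality (1 - 1/(x+1))ⁿ ≥ 1 - n/(x+1), cleared of denominators.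
bernoulli : ∀ x n → suc x ^ n * suc x ≤ x ^ n * suc x + n * suc x ^ n
bernoulli x zero    = ≤-reflexive (sym (+-identityʳ _))
bernoulli x (suc n) = begin
  suc x * X * suc x                              ≡⟨ *-assoc (suc x) X (suc x) ⟩
  suc x * (X * suc x)                            ≤⟨ *-monoʳ-≤ (suc x) (bernoulli x n) ⟩
  suc x * (Y * suc x + n * X)                    ≡⟨ expand x n X Y ⟩
  x * Y * suc x + n * (suc x * X) + Y * suc x    ≤⟨ +-monoʳ-≤ _ (*-monoˡ-≤ (suc x) (^-monoˡ-≤ n (n≤1+n x))) ⟩
  x * Y * suc x + n * (suc x * X) + X * suc x    ≡⟨ collect x n X Y ⟩
  x * Y * suc x + suc n * (suc x * X)            ∎
  where
  open ≤-Reasoning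
  X Y : ℕ
  X = suc x ^ n
  Y = x ^ n
  expand : ∀ x n X Y → suc x * (Y * suc x + n * X) ≡ x * Y * suc x + n * (suc x * X) + Y * suc x
  expand = solve-∀
  collect : ∀ x n X Y → x * Y * suc x + n * (suc x * X) + X * suc x ≡ x * Y * suc x + suc n * (suc x * X)
  collect = solve-∀

-- Bernoulli's inequality at x + 1 = (j+1)², with t = (x+1) − j = j² + j + 1.
n^n-logConvex : ∀ j → suc j ^ suc j * suc j ^ suc j ≤ suc (suc j) ^ suc (suc j) * j ^ j
n^n-logConvex j = *-cancelʳ-≤ _ _ (a * a) (begin
  a * A * (a * A) * (a * a)   ≡⟨ regroup₁ a A ⟩
  a * a * (a * a) * (A * A)   ≤⟨ *-monoˡ-≤ (A * A) quartic ⟩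
  t * (b * b) * (A * A)       ≡⟨ regroup₂ t b A ⟩
  b * b * (t * (A * A))       ≤⟨ *-monoʳ-≤ (b * b) bernoulli-at-square ⟩
  b * b * (C * B * (a * a))   ≡⟨ regroup₃ a b B C ⟩
  b * (b * B) * C * (a * a)   ∎)
  where
  open ≤-Reasoning
  a b A B C x t : ℕ
  a = suc j
  b = suc (suc j)
  A = a ^ j
  B = b ^ j
  C = j ^ j
  x = j * b
  t = j * j + j + 1
  regroup₁ : ∀ a A → a * A * (a * A) * (a * a) ≡ a * a * (a * a) * (A * A)
  regroup₁ = solve-∀
  regroup₂ : ∀ t b A → t * (b * b) * (A * A) ≡ b * b * (t * (A * A))
  regroup₂ = solve-∀
  regroup₃ : ∀ a b B C → b * b * (C * B * (a * a)) ≡ b * (b * B) * C * (a * a)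
  regroup₃ = solve-∀
  quartic : a * a * (a * a) ≤ t * (b * b)
  quartic = begin
    a * a * (a * a)                                         ≤⟨ m≤m+n _ _ ⟩
    a * a * (a * a) + (j * j * j + 3 * (j * j) + 4 * j + 3) ≡⟨ expand j ⟩
    t * (b * b)                                             ∎
    where
    expand : ∀ j → suc j * suc j * (suc j * suc j) + (j * j * j + 3 * (j * j) + 4 * j + 3)
                   ≡ (j * j + j + 1) * (suc (suc j) * suc (suc j))
    expand = solve-∀
  x+1≡a*a : ∀ j → suc (j * suc (suc j)) ≡ suc j * suc j
  x+1≡a*a = solve-∀
  bernoulli-at-square : t * (A * A) ≤ C * B * (a * a)
  bernoulli-at-square = +-cancelʳ-≤ (j * (A * A)) _ _ (begin
    t * (A * A) + j * (A * A)           ≡⟨ collect j (A * A) ⟩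
    A * A * (a * a)                     ≡⟨ cong (_* (a * a)) (^-distribʳ-* a a j) ⟨
    (a * a) ^ j * (a * a)               ≤⟨ bernoulli-at-a*a ⟩
    x ^ j * (a * a) + j * (a * a) ^ j   ≡⟨ cong₂ (λ X Y → X * (a * a) + j * Y) (^-distribʳ-* j b j) (^-distribʳ-* a a j) ⟩
    C * B * (a * a) + j * (A * A)       ∎)
    where
    collect : ∀ j P → (j * j + j + 1) * P + j * P ≡ P * (suc j * suc j)
    collect = solve-∀
    bernoulli-at-a*a : (a * a) ^ j * (a * a) ≤ x ^ j * (a * a) + j * (a * a) ^ j
    bernoulli-at-a*a = subst (λ y → y ^ j * y ≤ x ^ j * y + j * y ^ j) (x+1≡a*a j) (bernoulli x j)

module _ (s : ℕ → ℕ) (s≢0 : ∀ k → NonZero (s k))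
         (logConvex : ∀ k → s (suc k) * s (suc k) ≤ s (suc (suc k)) * s k) where

  logConvex⇒ratio-mono : ∀ {d M} → d ≤ M → s M * s (suc d) ≤ s (suc M) * s d
  logConvex⇒ratio-mono {d} d≤M = go (≤⇒≤′ d≤M)
    where
    open ≤-Reasoning
    go : ∀ {M} → d ≤′ M → s M * s (suc d) ≤ s (suc M) * s d
    go ≤′-refl = ≤-reflexive (*-comm (s d) (s (suc d)))
    go {suc M} (≤′-step d≤M) = *-cancelʳ-≤ _ _ (s M) {{s≢0 M}} (begin
      s (suc M) * s (suc d) * s M       ≡⟨ xy∙z≈x∙zy (s (suc M)) (s (suc d)) (s M) ⟩
      s (suc M) * (s M * s (suc d))     ≤⟨ *-monoʳ-≤ (s (suc M)) (go d≤M) ⟩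
      s (suc M) * (s (suc M) * s d)     ≡⟨ *-assoc (s (suc M)) (s (suc M)) (s d) ⟨
      s (suc M) * s (suc M) * s d       ≤⟨ *-monoˡ-≤ (s d) (logConvex M) ⟩
      s (suc (suc M)) * s M * s d       ≡⟨ xy∙z≈xz∙y (s (suc (suc M))) (s M) (s d) ⟩
      s (suc (suc M)) * s d * s M       ∎)

n^n≢0 : ∀ n → NonZero (n ^ n)
n^n≢0 zero    = _
n^n≢0 (suc n) = m^n≢0 (suc n) (suc n)

n^n-ratio-mono : ∀ {d M} → d ≤ M → M ^ M * suc d ^ suc d ≤ suc M ^ suc M * d ^ d
n^n-ratio-mono = logConvex⇒ratio-mono (λ n → n ^ n) n^n≢0 n^n-logConvex

cross-≤-trans : ∀ {a₁ b₁ a₂ b₂ a₃ b₃} .{{_ : NonZero b₂}} →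
                a₁ * b₂ ≤ a₂ * b₁ → a₂ * b₃ ≤ a₃ * b₂ → a₁ * b₃ ≤ a₃ * b₁
cross-≤-trans {a₁} {b₁} {a₂} {b₂} {a₃} {b₃} h₁₂ h₂₃ = *-cancelʳ-≤ _ _ b₂ (begin
  a₁ * b₃ * b₂   ≡⟨ xy∙z≈xz∙y a₁ b₃ b₂ ⟩
  a₁ * b₂ * b₃   ≤⟨ *-monoˡ-≤ b₃ h₁₂ ⟩
  a₂ * b₁ * b₃   ≡⟨ xy∙z≈xz∙y a₂ b₁ b₃ ⟩
  a₂ * b₃ * b₁   ≤⟨ *-monoˡ-≤ b₁ h₂₃ ⟩
  a₃ * b₂ * b₁   ≡⟨ xy∙z≈xz∙y a₃ b₂ b₁ ⟩
  a₃ * b₁ * b₂   ∎)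
  where open ≤-Reasoning

module _ {c ℓ} (M : CommutativeMonoid c ℓ) where
  open CommutativeMonoid M using (Carrier; _≈_; _∙_; ε; ∙-congˡ; ∙-congʳ; setoid; commutativeSemigroup)
  open import Algebra.Properties.CommutativeMonoid.Sum M using (sum-remove; sum-cong-≋) renaming (sum to ∑)
  open CommSemigroupProperties commutativeSemigroup using (xy∙z≈zy∙x)
  open import Relation.Binary.Reasoning.Setoid setoid

  foldr-tabulate : ∀ {k} (f : Fin k → Carrier) → foldr _∙_ ε (tabulate f) ≡ ∑ f
  foldr-tabulate {zero}  f = refl
  foldr-tabulate {suc k} f = cong (f Fin.zero ∙_) (foldr-tabulate (f ∘ Fin.suc))

  foldr-allFin : ∀ {k} (f : Fin k → Carrier) → foldr _∙_ ε (map f (allFin k)) ≡ ∑ f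
  foldr-allFin f = trans (cong (foldr _∙_ ε) (map-tabulate id f)) (foldr-tabulate f)

  foldr-allFin-update : ∀ {k} (f g : Fin k → Carrier) (e : Fin k) → (∀ i → i ≢ e → f i ≈ g i) →
                        foldr _∙_ ε (map f (allFin k)) ∙ g e ≈ foldr _∙_ ε (map g (allFin k)) ∙ f e
  foldr-allFin-update {suc k} f g e f≈g = begin
    foldr _∙_ ε (map f (allFin _)) ∙ g e  ≡⟨ cong (_∙ g e) (foldr-allFin f) ⟩
    ∑ f ∙ g e                             ≈⟨ ∙-congʳ (sum-remove f) ⟩
    (f e ∙ ∑ (removeAt f e)) ∙ g e        ≈⟨ xy∙z≈zy∙x (f e) _ (g e) ⟩
    (g e ∙ ∑ (removeAt f e)) ∙ f e        ≈⟨ ∙-congʳ (∙-congˡ (sum-cong-≋ (λ j → f≈g _ (punchInᵢ≢i e j)))) ⟩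
    (g e ∙ ∑ (removeAt g e)) ∙ f e        ≈⟨ ∙-congʳ (sum-remove g) ⟨
    ∑ g ∙ f e                             ≡⟨ cong (_∙ f e) (foldr-allFin g) ⟨
    foldr _∙_ ε (map g (allFin _)) ∙ f e  ∎

isYes-true : ∀ {p} {P : Set p} (P? : Dec P) → P → isYes P? ≡ true
isYes-true P? p = trans (isYes≗does P?) (dec-true P? p)

isYes-false : ∀ {p} {P : Set p} (P? : Dec P) → ¬ P → isYes P? ≡ false
isYes-false P? ¬p = trans (isYes≗does P?) (dec-false P? ¬p)

sum-map-mono : ∀ {a} {A : Set a} {f g : A → ℕ} (xs : List A) → (∀ x → f x ≤ g x) →
               sum (map f xs) ≤ sum (map g xs)
sum-map-mono []       f≤g = z≤n
sum-map-mono (x ∷ xs) f≤g = +-mono-≤ (f≤g x) (sum-map-mono xs f≤g)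

b2n-∧-≤ : ∀ a b → b2n (a ∧ b) ≤ b2n a
b2n-∧-≤ true  true  = ≤-refl
b2n-∧-≤ true  false = z≤n
b2n-∧-≤ false _     = z≤n

module _ {a} {A : Set a} where

  unique-++⁻ʳ : ∀ (xs : List A) {ys} → Unique (xs ++ ys) → Unique ys
  unique-++⁻ʳ []       u       = u
  unique-++⁻ʳ (_ ∷ xs) (_ ∷ u) = unique-++⁻ʳ xs u

  unique-++⁻-∉ : ∀ (xs : List A) {x ys} → Unique (xs ++ x ∷ ys) → x ∉ₗ xs
  unique-++⁻-∉ (_ ∷ xs) (y∉ ∷ _) (here refl) = All.head (++⁻ʳ xs y∉) refl
  unique-++⁻-∉ (_ ∷ xs) (_ ∷ u)  (there x∈) = unique-++⁻-∉ xs u x∈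

module _ {a r} {A : Set a} (_≼_ : Rel A r) (total : Total _≼_) (≼-trans : Transitive _≼_) where

  subset-argmin : ∀ {k} (f : Subset k → A) → ∃ λ S → ∀ S′ → f S ≼ f S′
  subset-argmin {zero}  f = Vec.[] , λ { Vec.[] → [ id , id ]′ (total (f _) (f _)) }
  subset-argmin {suc k} f with subset-argmin (f ∘ (inside Vec.∷_)) | subset-argmin (f ∘ (outside Vec.∷_))
  ... | S₁ , min₁ | S₀ , min₀ with total (f (inside Vec.∷ S₁)) (f (outside Vec.∷ S₀))
  ... | inj₁ ≼₀ = inside Vec.∷ S₁ , λ { (inside  Vec.∷ S) → min₁ S
                                      ; (outside Vec.∷ S) → ≼-trans ≼₀ (min₀ S) }
  ... | inj₂ ≽₀ = outside Vec.∷ S₀ , λ { (inside  Vec.∷ S) → ≼-trans ≽₀ (min₁ S)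
                                       ; (outside Vec.∷ S) → min₀ S }

module _ (G : Digraph) where
  open import Data.List.Membership.DecPropositional (_≟_ {n = m G}) using () renaming (_∈?_ to _∈ₗ?_)

  private
    V E : Set
    V = Fin (n G)
    E = Fin (m G)
    variable
      S S′ T F : EdgeSet G
      u v w x y : V
      e i : E
      es xs ys l : List E

  insert : E → EdgeSet G → EdgeSet G
  insert e F = F [ e ]≔ true

  ∈-insert : e ∈ insert e F
  ∈-insert {e} {F} = lookup⇒[]= e (insert e F) (lookup∘update e F true)

  ⊆-insert : F ⊆ insert e F
  ⊆-insert {F} {e} {i} i∈F with i ≟ e
  ... | yes refl = ∈-insert
  ... | no  i≢e  = lookup⇒[]= i (insert e F) (trans (lookup∘update′ i≢e F true) ([]=⇒lookup i∈F))

  ∈-insert⁻ : i ∈ insert e F → i ≡ e ⊎ i ∈ F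
  ∈-insert⁻ {i} {e} {F} i∈ with i ≟ e
  ... | yes i≡e = inj₁ i≡e
  ... | no  i≢e = inj₂ (lookup⇒[]= i F (trans (sym (lookup∘update′ i≢e F true)) ([]=⇒lookup i∈)))

  insert-⊆ : e ∈ S → F ⊆ S → insert e F ⊆ S
  insert-⊆ e∈S F⊆S i∈ with ∈-insert⁻ i∈
  ... | inj₁ refl = e∈S
  ... | inj₂ i∈F  = F⊆S i∈F

  countKept : EdgeSet G → (E → Bool) → ℕ
  countKept F c = sum (map (λ i → b2n (kept G F i ∧ c i)) (allFin (m G)))

  kept-insert : kept G (insert e F) e ≡ false
  kept-insert {e} {F} = cong not (lookup∘update e F true)

  kept-insert-other : i ≢ e → kept G (insert e F) i ≡ kept G F i
  kept-insert-other {F = F} i≢e = cong not (lookup∘update′ i≢e F true)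

  kept-∉ : e ∉ F → kept G F e ≡ true
  kept-∉ {e} {F} e∉F = cong not (¬-not (e∉F ∘ lookup⇒[]= e F))

  countKept-insert : e ∉ F → ∀ c → countKept F c ≡ b2n (c e) + countKept (insert e F) c
  countKept-insert {e} {F} e∉F c = begin-equality
    countKept F c                             ≡⟨ +-identityʳ _ ⟨
    countKept F c + b2n (false ∧ c e)         ≡⟨ cong (λ b → countKept F c + b2n (b ∧ c e)) (kept-insert {e = e} {F = F}) ⟨
    countKept F c + b2n (kept G F′ e ∧ c e)   ≡⟨ update ⟩
    countKept F′ c + b2n (kept G F e ∧ c e)   ≡⟨ cong (λ b → countKept F′ c + b2n (b ∧ c e)) (kept-∉ e∉F) ⟩
    countKept F′ c + b2n (c e)                ≡⟨ +-comm _ (b2n (c e)) ⟩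
    b2n (c e) + countKept F′ c                ∎
    where
    open ≤-Reasoning
    F′ : EdgeSet G
    F′ = insert e F
    update : countKept F c + b2n (kept G F′ e ∧ c e) ≡ countKept F′ c + b2n (kept G F e ∧ c e)
    update = foldr-allFin-update +-0-commutativeMonoid
               (λ i → b2n (kept G F i ∧ c i)) (λ i → b2n (kept G F′ i ∧ c i)) e
               (λ i i≢e → cong (λ b → b2n (b ∧ c i)) (sym (kept-insert-other {F = F} i≢e)))

  edgesLeft≡countKept : ∀ F → edgesLeft G F ≡ countKept F (λ _ → true)
  edgesLeft≡countKept F = cong sum (map-cong (λ i → cong b2n (sym (∧-identityʳ _))) (allFin (m G)))

  edgesLeft-insert : e ∉ F → edgesLeft G F ≡ suc (edgesLeft G (insert e F))
  edgesLeft-insert {e} {F} e∉F =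
    trans (edgesLeft≡countKept F) (trans (countKept-insert e∉F _) (cong suc (sym (edgesLeft≡countKept (insert e F)))))

  indeg-insert : e ∉ F → indeg G F (tgt G e) ≡ suc (indeg G (insert e F) (tgt G e))
  indeg-insert {e} {F} e∉F =
    trans (countKept-insert e∉F _)
          (cong (λ b → b2n b + indeg G (insert e F) (tgt G e)) (isYes-true (tgt G e ≟ tgt G e) refl))

  indeg-insert-other : e ∉ F → v ≢ tgt G e → indeg G F v ≡ indeg G (insert e F) v
  indeg-insert-other {e} {F} {v} e∉F v≢ =
    trans (countKept-insert e∉F _)
          (cong (λ b → b2n b + indeg G (insert e F) v) (isYes-false (tgt G e ≟ v) (v≢ ∘ sym)))

  indeg≤edgesLeft : ∀ F v → indeg G F v ≤ edgesLeft G F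
  indeg≤edgesLeft F v = sum-map-mono (allFin (m G)) (λ i → b2n-∧-≤ (kept G F i) _)

  expHden≢0 : ∀ F → NonZero (expHden G F)
  expHden≢0 F = product≢0 (map⁺ (All.universal (λ v → n^n≢0 (indeg G F v)) (allFin (n G))))

  H≤-total : Total (H≤ G)
  H≤-total F F′ = ≤-total (expHnum G F * expHden G F′) (expHnum G F′ * expHden G F)

  H≤-trans : ∀ F₁ F₂ F₃ → H≤ G F₁ F₂ → H≤ G F₂ F₃ → H≤ G F₁ F₃
  H≤-trans F₁ F₂ F₃ = cross-≤-trans {expHnum G F₁} {expHden G F₁} {expHnum G F₂} {expHden G F₂}
                                           {expHnum G F₃} {expHden G F₃} {{expHden≢0 F₂}}

  H≤-insert : e ∉ F → H≤ G (insert e F) F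
  H≤-insert {e} {F} e∉F = *-cancelʳ-≤ _ _ (d ^ d) {{n^n≢0 d}} (begin
    M ^ M * D * d ^ d               ≡⟨ *-assoc (M ^ M) D (d ^ d) ⟩
    M ^ M * (D * d ^ d)             ≡⟨ cong (M ^ M *_) den-update ⟩
    M ^ M * (D′ * suc d ^ suc d)    ≡⟨ x∙yz≈xz∙y (M ^ M) D′ (suc d ^ suc d) ⟩
    M ^ M * suc d ^ suc d * D′      ≤⟨ *-monoˡ-≤ D′ (n^n-ratio-mono (indeg≤edgesLeft (insert e F) (tgt G e))) ⟩
    suc M ^ suc M * d ^ d * D′      ≡⟨ xy∙z≈xz∙y (suc M ^ suc M) (d ^ d) D′ ⟩
    suc M ^ suc M * D′ * d ^ d      ≡⟨ cong (λ k → k ^ k * D′ * d ^ d) (edgesLeft-insert e∉F) ⟨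
    expHnum G F * D′ * d ^ d        ∎)
    where
    open ≤-Reasoning
    M d D D′ : ℕ
    M = edgesLeft G (insert e F)
    d = indeg G (insert e F) (tgt G e)
    D = expHden G F
    D′ = expHden G (insert e F)
    den-update : D * d ^ d ≡ D′ * suc d ^ suc d
    den-update = trans
      (foldr-allFin-update *-1-commutativeMonoid
        (λ v → indeg G F v ^ indeg G F v) (λ v → indeg G (insert e F) v ^ indeg G (insert e F) v) (tgt G e)
        (λ v v≢ → cong (λ k → k ^ k) (indeg-insert-other e∉F v≢)))
      (cong (λ k → D′ * k ^ k) (indeg-insert e∉F))

  _++ʷ_ : Walk G S u v xs → Walk G S v w ys → Walk G S u w (xs ++ ys)
  stop        ++ʷ q = q
  fwd e p w′ ++ʷ q = fwd e p (w′ ++ʷ q)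
  bwd e p w′ ++ʷ q = bwd e p (w′ ++ʷ q)

  walk-mono : S ⊆ S′ → Walk G S u v es → Walk G S′ u v es
  walk-mono S⊆S′ stop        = stop
  walk-mono S⊆S′ (fwd e p w) = fwd e (S⊆S′ p) (walk-mono S⊆S′ w)
  walk-mono S⊆S′ (bwd e p w) = bwd e (S⊆S′ p) (walk-mono S⊆S′ w)

  walk-edges : Walk G S u v es → All (_∈ S) es
  walk-edges stop        = []
  walk-edges (fwd e p w) = p ∷ walk-edges w
  walk-edges (bwd e p w) = p ∷ walk-edges w

  walk-split : ∀ xs → Walk G S u v (xs ++ e ∷ ys) →
               ∃₂ λ x y → Walk G S u x xs × Walk G S x y [ e ] × Walk G S y v ys
  walk-split []       (fwd e p w) = _ , _ , stop , fwd e p stop , w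
  walk-split []       (bwd e p w) = _ , _ , stop , bwd e p stop , w
  walk-split (_ ∷ xs) (fwd e p w) with walk-split xs w
  ... | _ , _ , before , step , after = _ , _ , fwd e p before , step , after
  walk-split (_ ∷ xs) (bwd e p w) with walk-split xs w
  ... | _ , _ , before , step , after = _ , _ , bwd e p before , step , after

  walk-uninsert : Walk G (insert e S) u v es → e ∉ₗ es → Walk G S u v es
  walk-uninsert stop        e∉ = stop
  walk-uninsert (fwd i p w) e∉ with ∈-insert⁻ p
  ... | inj₁ refl = ⊥-elim (e∉ (here refl))
  ... | inj₂ i∈S  = fwd i i∈S (walk-uninsert w (e∉ ∘ there))
  walk-uninsert (bwd i p w) e∉ with ∈-insert⁻ p
  ... | inj₁ refl = ⊥-elim (e∉ (here refl))
  ... | inj₂ i∈S  = bwd i i∈S (walk-uninsert w (e∉ ∘ there))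

  Reachable : EdgeSet G → V → V → Set
  Reachable S u v = ∃ (Walk G S u v)

  reach-refl : Reachable S u u
  reach-refl = [] , stop

  reach-trans : Reachable S u v → Reachable S v w → Reachable S u w
  reach-trans (_ , p) (_ , q) = _ , p ++ʷ q

  reach-sym : Reachable S u v → Reachable S v u
  reach-sym (_ , stop)      = reach-refl
  reach-sym (_ , fwd e p w) = reach-trans (reach-sym (_ , w)) (_ , bwd e p stop)
  reach-sym (_ , bwd e p w) = reach-trans (reach-sym (_ , w)) (_ , fwd e p stop)

  reach-mono : S ⊆ S′ → Reachable S u v → Reachable S′ u v
  reach-mono S⊆S′ (_ , w) = _ , walk-mono S⊆S′ w

  reach-via-edges : (∀ {e} → e ∈ S → Reachable T (src G e) (tgt G e)) → Reachable S u v → Reachable T u v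
  reach-via-edges joined (_ , stop)      = reach-refl
  reach-via-edges joined (_ , fwd e p w) = reach-trans (joined p) (reach-via-edges joined (_ , w))
  reach-via-edges joined (_ , bwd e p w) = reach-trans (reach-sym (joined p)) (reach-via-edges joined (_ , w))

  Trail : EdgeSet G → V → V → Set
  Trail S u v = ∃ λ es → Walk G S u v es × Unique es

  -- The first step crosses e, which the trail crosses again later: skip ahead to the end
  -- of that later crossing.
  trail-shortcut : Walk G S u x [ e ] → Walk G S y w [ e ] → Walk G S w v es → Unique (e ∷ es) → Trail S u v
  trail-shortcut (fwd e p stop) (fwd _ _ stop) rest u       = _ , fwd e p rest , u
  trail-shortcut (fwd _ _ stop) (bwd _ _ stop) rest (_ ∷ u) = _ , rest , u
  trail-shortcut (bwd _ _ stop) (fwd _ _ stop) rest (_ ∷ u) = _ , rest , u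
  trail-shortcut (bwd e p stop) (bwd _ _ stop) rest u       = _ , bwd e p rest , u

  trail-cons : Walk G S u x [ e ] → Trail S x v → Trail S u v
  trail-cons {e = e} step (es , w , u) with e ∈ₗ? es
  ... | no e∉es = e ∷ es , step ++ʷ w , ¬Any⇒All¬ es e∉es ∷ u
  ... | yes e∈es with ∈-∃++ e∈es
  ... | xs , _ , refl with walk-split xs w
  ... | _ , _ , _ , crossing , rest = trail-shortcut step crossing rest (unique-++⁻ʳ xs u)

  trail : Walk G S u v es → Trail S u v
  trail stop        = [] , stop , []
  trail (fwd e p w) = trail-cons (fwd e p stop) (trail w)
  trail (bwd e p w) = trail-cons (bwd e p stop) (trail w)

  walk-∅ : Walk G ∅ u v es → u ≡ v × es ≡ []
  walk-∅ stop        = refl , refl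
  walk-∅ (fwd e p _) = ⊥-elim (∉⊥ p)
  walk-∅ (bwd e p _) = ⊥-elim (∉⊥ p)

  acyclic-∅ : Acyclic G ∅
  acyclic-∅ v es w _ = proj₂ (walk-∅ w)

  acyclic-insert : Acyclic G S → ¬ Reachable S (src G e) (tgt G e) → Acyclic G (insert e S)
  acyclic-insert {e = e} acyclic unjoined v es w u with e ∈ₗ? es
  ... | no e∉es = acyclic v es (walk-uninsert w e∉es) u
  ... | yes e∈es with ∈-∃++ e∈es
  ... | xs , _ , refl with walk-split xs w
  ... | _ , _ , before , crossing , after = ⊥-elim (unjoined (joins crossing
        (walk-uninsert after (Unique[x∷xs]⇒x∉xs (unique-++⁻ʳ xs u)) ++ʷ
         walk-uninsert before (unique-++⁻-∉ xs u))))
    where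
    joins : ∀ {x y zs} → Walk G (insert e S) x y [ e ] → Walk G S y x zs → Reachable S (src G e) (tgt G e)
    joins (fwd _ _ stop) w = reach-sym (_ , w)
    joins (bwd _ _ stop) w = _ , w

  acyclic⇒unreachable : Acyclic G S → e ∈ S → F ⊆ S → e ∉ F → ¬ Reachable F (src G e) (tgt G e)
  acyclic⇒unreachable {e = e} acyclic e∈S F⊆S e∉F (_ , w) with trail w
  ... | es , w′ , u with acyclic _ (e ∷ es) (bwd e e∈S (walk-mono F⊆S w′))
                                 (All.map (λ { i∈F refl → e∉F i∈F }) (walk-edges w′) ∷ u)
  ... | ()

  ReachesEnd : EdgeSet G → E → V → Set
  ReachesEnd S e u = Reachable S u (src G e) ⊎ Reachable S u (tgt G e)

  ReachedFromEnd : EdgeSet G → E → V → Set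
  ReachedFromEnd S e v = Reachable S (src G e) v ⊎ Reachable S (tgt G e) v

  ReachableVia : EdgeSet G → E → V → V → Set
  ReachableVia S e u v = Reachable S u v ⊎ (ReachesEnd S e u × ReachedFromEnd S e v)

  reachableVia-cons : Reachable S u x → ReachableVia S e x v → ReachableVia S e u v
  reachableVia-cons r = map⊎ (reach-trans r) (map₁ (map⊎ (reach-trans r) (reach-trans r)))

  reachable-insert⁻ : Walk G (insert e S) u v es → ReachableVia S e u v
  reachable-insert⁻ stop = inj₁ reach-refl
  reachable-insert⁻ (fwd i p w) with ∈-insert⁻ p
  ... | inj₁ refl = inj₂ (inj₁ reach-refl , [ inj₂ , proj₂ ]′ (reachable-insert⁻ w))
  ... | inj₂ i∈S  = reachableVia-cons (_ , fwd i i∈S stop) (reachable-insert⁻ w)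
  reachable-insert⁻ (bwd i p w) with ∈-insert⁻ p
  ... | inj₁ refl = inj₂ (inj₂ reach-refl , [ inj₁ , proj₂ ]′ (reachable-insert⁻ w))
  ... | inj₂ i∈S  = reachableVia-cons (_ , bwd i i∈S stop) (reachable-insert⁻ w)

  reachable-insert⁺ : ReachableVia S e u v → Reachable (insert e S) u v
  reachable-insert⁺ (inj₁ r) = reach-mono ⊆-insert r
  reachable-insert⁺ {S} {e} (inj₂ (to , from)) = reach-trans (to-src to) (from-src from)
    where
    to-src : ReachesEnd S e u → Reachable (insert e S) u (src G e)
    to-src = [ reach-mono ⊆-insert , (λ r → reach-trans (reach-mono ⊆-insert r) (_ , bwd e ∈-insert stop)) ]′
    from-src : ReachedFromEnd S e v → Reachable (insert e S) (src G e) v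
    from-src = [ reach-mono ⊆-insert , (λ r → reach-trans (_ , fwd e ∈-insert stop) (reach-mono ⊆-insert r)) ]′

  fromList : List E → EdgeSet G
  fromList = foldr insert ∅

  reachable? : ∀ l u v → Dec (Reachable (fromList l) u v)
  reachable? []      u v = map′ (λ { refl → reach-refl }) (proj₁ ∘ walk-∅ ∘ proj₂) (u ≟ v)
  reachable? (e ∷ l) u v = map′ reachable-insert⁺ (reachable-insert⁻ ∘ proj₂)
    (r u v ⊎-dec (r u (src G e) ⊎-dec r u (tgt G e)) ×-dec (r (src G e) v ⊎-dec r (tgt G e) v))
    where
    r : ∀ u v → Dec (Reachable (fromList l) u v)
    r = reachable? l

  extend : E → List E → List E
  extend e acc with reachable? acc (src G e) (tgt G e)
  ... | yes _ = acc
  ... | no  _ = e ∷ acc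

  module _ (e : E) (acc : List E) where

    extend-⊇ : fromList acc ⊆ fromList (extend e acc)
    extend-⊇ with reachable? acc (src G e) (tgt G e)
    ... | yes _ = id
    ... | no  _ = ⊆-insert

    extend-reach : Reachable (fromList (extend e acc)) (src G e) (tgt G e)
    extend-reach with reachable? acc (src G e) (tgt G e)
    ... | yes r = r
    ... | no  _ = _ , fwd e ∈-insert stop

    extend-acyclic : Acyclic G (fromList acc) → Acyclic G (fromList (extend e acc))
    extend-acyclic acyclic with reachable? acc (src G e) (tgt G e)
    ... | yes _  = acyclic
    ... | no  ¬r = acyclic-insert acyclic ¬r

    extend-H≤ : H≤ G (fromList (extend e acc)) (fromList acc)
    extend-H≤ with reachable? acc (src G e) (tgt G e)
    ... | yes _  = ≤-refl
    ... | no  ¬r = H≤-insert (λ e∈ → ¬r (_ , fwd e e∈ stop))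

    extend-⊆ : e ∈ S → fromList acc ⊆ S → fromList (extend e acc) ⊆ S
    extend-⊆ e∈S acc⊆S with reachable? acc (src G e) (tgt G e)
    ... | yes _ = acc⊆S
    ... | no  _ = insert-⊆ e∈S acc⊆S

    extend-∈ : Acyclic G S → e ∈ S → fromList acc ⊆ S → e ∈ fromList (extend e acc)
    extend-∈ acyclic e∈S acc⊆S with reachable? acc (src G e) (tgt G e)
    ... | no  _ = ∈-insert
    ... | yes r with e ∈ₛ? fromList acc
    ...   | yes e∈ = e∈
    ...   | no  e∉ = ⊥-elim (acyclic⇒unreachable acyclic e∈S acc⊆S e∉ r)

  greedy : List E → List E → List E
  greedy acc = foldr extend acc

  module _ {acc : List E} where

    greedy-⊇ : ∀ l → fromList acc ⊆ fromList (greedy acc l)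
    greedy-⊇ []      = id
    greedy-⊇ (e ∷ l) = extend-⊇ e (greedy acc l) ∘ greedy-⊇ l

    greedy-reach : e ∈ₗ l → Reachable (fromList (greedy acc l)) (src G e) (tgt G e)
    greedy-reach {l = e ∷ l} (here refl) = extend-reach e (greedy acc l)
    greedy-reach {l = e ∷ l} (there e∈l) = reach-mono (extend-⊇ e (greedy acc l)) (greedy-reach e∈l)

    greedy-acyclic : Acyclic G (fromList acc) → ∀ l → Acyclic G (fromList (greedy acc l))
    greedy-acyclic acyclic []      = acyclic
    greedy-acyclic acyclic (e ∷ l) = extend-acyclic e (greedy acc l) (greedy-acyclic acyclic l)

    greedy-H≤ : ∀ l → H≤ G (fromList (greedy acc l)) (fromList acc)
    greedy-H≤ []      = ≤-refl
    greedy-H≤ (e ∷ l) = H≤-trans (fromList (greedy acc (e ∷ l))) (fromList (greedy acc l)) (fromList acc)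
                                 (extend-H≤ e (greedy acc l)) (greedy-H≤ l)

    greedy-⊆ : All (_∈ S) l → fromList acc ⊆ S → fromList (greedy acc l) ⊆ S
    greedy-⊆ []                      acc⊆S = acc⊆S
    greedy-⊆ {l = e ∷ l} (e∈S ∷ l⊆S) acc⊆S = extend-⊆ e (greedy acc l) e∈S (greedy-⊆ l⊆S acc⊆S)

    greedy-∈ : Acyclic G S → All (_∈ S) l → fromList acc ⊆ S → e ∈ₗ l → e ∈ fromList (greedy acc l)
    greedy-∈ {l = e ∷ l} acyclic (e∈S ∷ l⊆S) acc⊆S (here refl) =
      extend-∈ e (greedy acc l) acyclic e∈S (greedy-⊆ l⊆S acc⊆S)
    greedy-∈ {l = e ∷ l} acyclic (_ ∷ l⊆S)   acc⊆S (there e∈l) =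
      extend-⊇ e (greedy acc l) (greedy-∈ acyclic l⊆S acc⊆S e∈l)

  elements : EdgeSet G → List E
  elements S = filter (_∈ₛ? S) (allFin (m G))

  greedy-elements : Acyclic G S → fromList (greedy [] (elements S)) ≡ S
  greedy-elements {S} acyclic = ⊆-antisym (greedy-⊆ elements⊆S ⊥⊆)
    (λ {i} i∈S → greedy-∈ acyclic elements⊆S ⊥⊆ (∈-filter⁺ (_∈ₛ? S) (∈-allFin i) i∈S))
    where
    elements⊆S : All (_∈ S) (elements S)
    elements⊆S = all-filter (_∈ₛ? S) (allFin (m G))

  spanningTree : EdgeSet G → EdgeSet G
  spanningTree S = fromList (greedy (greedy [] (elements S)) (allFin (m G)))

  spanningTree-spans : WeaklyConnected G → ∀ S → SpanningTree G (spanningTree S)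
  spanningTree-spans connected S =
    greedy-acyclic (greedy-acyclic acyclic-∅ (elements S)) (allFin (m G)) ,
    λ u v → reach-via-edges (λ {e} _ → greedy-reach (∈-allFin e)) (connected u v)

  spanningTree-H≤ : Acyclic G S → H≤ G (spanningTree S) S
  spanningTree-H≤ {S} acyclic =
    subst (H≤ G (spanningTree S)) (greedy-elements acyclic) (greedy-H≤ (allFin (m G)))

lemma30 : (G : Digraph) → WeaklyConnected G →
          Σ (EdgeSet G) (λ T → SpanningTree G T ×
            ((F : EdgeSet G) → SpanningForest G F → H≤ G T F))
lemma30 G connected
  with subset-argmin (H≤ G) (H≤-total G) (λ {F₁ F₂ F₃} → H≤-trans G F₁ F₂ F₃) (spanningTree G)
... | S₀ , minimal =
  spanningTree G S₀ , spanningTree-spans G connected S₀ ,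
  λ F forest → H≤-trans G (spanningTree G S₀) (spanningTree G F) F (minimal F) (spanningTree-H≤ G forest)
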